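{- Let $k,d \in \mathbb{N}$, $A \subseteq L(T_{k,d})$, and let $\beta = (f_v)_{v \in V(T_{k,d})}$ be a scheme for $T_{k,d}$. Suppose that there exists a collision with respect to $(A,\beta)$. Let $I = (D,k,\mathcal{T})$ be a no-instance of DAG Disjoint Paths. Then no solution to the instance $(D',k^d,\mathcal{T}') = J_{k,d}(I,\beta)$ can simultaneously serve all the requests $(s_v,t_v)$, $v \in A$.
   Context: An instance $I=(D,k,\mathcal{T})$ of DAG Disjoint Paths consists of an acyclic digraph $D$ and $k$ requests $(s_i,t_i)\in V(D)^2$, $i\in[k]$. A solution is a collection of pairwise vertex-disjoint paths, each an $(s_i,t_i)$-path for some request; it serves the requests for which it contains such a path. $I$ is a yes-instance if some solution serves all $k$ requests, and a no-instance otherwise. $T_{k,d}$ is the full $k$-ary rooted tree of depth $d$ (root of depth $0$, $k^d$ leaves at depth $d$). $L(T)$ is the set of leaves of a rooted tree $T$, $T^v_{k,d}$ is the subtree rooted at $v$, and $\mathsf{Children}(v)$ is the set of children of $v$. A scheme for $T_{k,d}$ is a collection $\beta=(f_v)_{v\in V(T_{k,d})}$ where each $f_v$ is a bijection from $L(T^v_{k,d})$ to $\{1,\dots,|L(T^v_{k,d})|\}$. A node $u\in V(T_{k,d})$ forms a collision with respect to $(A,\beta)$ if $A$ contains elements $a_1,\dots,a_k$ such that for each $i\in[k]$, $a_i$ is a descendant of $u_i\in\mathsf{Children}(u)$ where $u_1,\dots,u_k$ are distinct, and $f_{u_1}(a_1)=f_{u_2}(a_2)=\dots=f_{u_k}(a_k)$.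 There exists a collision with respect to $(A,\beta)$ if some node forms one. The instance $J_{k,d}(I,\beta)=(D',k^d,\mathcal{T}')$, whose requests are indexed by the leaves of $T_{k,d}$ as $(s_v,t_v)_{v\in L(T_{k,d})}$, is defined recursively. If $d=1$, $J_{k,1}(I,\beta)=I$, with the requests of $I$ indexed by the $k$ leaves of $T_{k,1}$ in an arbitrary order. If $d>1$, let $u_1,\dots,u_k$ be the children of the root; let $\beta_i$ be the restriction of $\beta$ to the nodes of $T^{u_i}_{k,d}$ (a copy of $T_{k,d-1}$) and $J_i=J_{k,d-1}(I,\beta_i)$, whose requests are indexed by the leaves of $T^{u_i}_{k,d}$. Take the disjoint union of $J_1,\dots,J_k$ and $k^{d-1}$ copies $I_1,\dots,I_{k^{d-1}}$ of $I$; write $I_j[x]$ for the copy in $I_j$ of a vertex $x$ of $D$ and $J_i[s_v],J_i[t_v]$ for the endpoints of request $v$ of $J_i$. For each $i\in[k]$ and each leaf $v$ of $T^{u_i}_{k,d}$, add an arc from $J_i[t_v]$ to $I_{f_{u_i}(v)}[s_i]$, and add the request $(J_i[s_v],\, I_{f_{u_i}(v)}[t_i])$ to $\mathcal{T}'$, indexed by the leaf $v$ (viewed as a leaf of $T_{k,d}$). -}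

module Defs where

open import Level using (0ℓ)
open import Data.Nat using (ℕ; zero; suc; _^_)
open import Data.Fin using (Fin)
open import Data.Vec using (Vec; _∷_)
open import Data.List using (List; []; _∷_)
open import Data.List.Membership.Propositional using (_∈_)
open import Data.List.Relation.Unary.All using (All)
open import Data.List.Relation.Unary.Any using (Any)
open import Data.List.Relation.Unary.AllPairs using (AllPairs)
open import Data.List.Relation.Unary.Unique.Propositional using (Unique)
open import Data.Product using (Σ; Σ-syntax; ∃; _×_; _,_; proj₁; proj₂)
open import Data.Sum using (_⊎_; inj₁; inj₂)
open import Data.Empty using (⊥)
open import Relation.Nullary using (¬_)
open import Relation.Unary using (Pred)
open import Relation.Binary.PropositionalEquality using (_≡_)
open import Function.Bundles using (_⤖_; _↔_; Bijection)
open import Function.Definitions using (Injective)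

record Digraph : Set₁ where
  field
    V   : Set
    Arc : V → V → Set
open Digraph public

module _ (D : Digraph) where

  data Walk : V D → V D → Set where
    []  : ∀ {x} → Walk x x
    _∷_ : ∀ {x y z} → Arc D x y → Walk y z → Walk x z

  walkVerts : ∀ {x y} → Walk x y → List (V D)
  walkVerts {x} []      = x ∷ []
  walkVerts {x} (_ ∷ w) = x ∷ walkVerts w

  record Path (x y : V D) : Set where
    constructor mkPath
    field
      walk   : Walk x y
      simple : Unique (walkVerts walk)

  record SomePath : Set where
    constructor somePath
    field
      start : V D
      end   : V D
      path  : Path start end

  pathVerts : SomePath → List (V D)
  pathVerts p = walkVerts (Path.walk (SomePath.path p))

  Acyclic : Set
  Acyclic = ∀ {x y} → Arc D x y → Walk y x → ⊥

  FiniteVertices : Set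
  FiniteVertices = Σ ℕ λ n → Fin n ↔ V D

  -- an acyclic digraph (finite, as always in DAG Disjoint Paths)
  IsDAG : Set
  IsDAG = FiniteVertices × Acyclic

-- Instances of (DAG) Disjoint Paths, with requests indexed by a type R
-- (R = Fin k for an instance with k requests).

record Instance (R : Set) : Set₁ where
  field
    graph : Digraph
    src   : R → V graph
    tgt   : R → V graph
open Instance public

Disjoint : {X : Set} → List X → List X → Set
Disjoint xs ys = ∀ {v} → v ∈ xs → v ∈ ys → ⊥

module _ {R : Set} (I : Instance R) where

  IsPathFor : SomePath (graph I) → R → Set
  IsPathFor p r = (SomePath.start p ≡ src I r) × (SomePath.end p ≡ tgt I r)

  record Solution : Set where
    field
      paths      : List (SomePath (graph I))
      forRequest : All (λ p → Σ R (IsPathFor p)) paths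
      disjoint   : AllPairs (λ p q → Disjoint (pathVerts (graph I) p)
                                              (pathVerts (graph I) q)) paths
  open Solution public

  Serves : Solution → R → Set
  Serves S r = Any (λ p → IsPathFor p r) (paths S)

  YesInstance : Set
  YesInstance = Σ Solution λ S → ∀ r → Serves S r

  NoInstance : Set
  NoInstance = ¬ YesInstance

-- A node of depth m is its address from the root, a Vec (Fin k) m; the
-- leaves are Vec (Fin k) d.  The leaves of the subtree rooted at a node u
-- of depth m are identified with their addresses relative to u, i.e. with
-- Vec (Fin k) (d - m); there are k ^ (d - m) of them.
--
-- A scheme for T_{k,d} assigns to every node v a bijection f_v from the
-- leaves of T^v_{k,d} to {1,..,|L(T^v_{k,d})|}; we use Fin (k ^ h)
-- (i.e. {0,..,k^h - 1}) for {1,..,k^h}.  It is given recursively: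
-- the bijection at the root, together with a scheme for each subtree
-- rooted at a child of the root.

Scheme : ℕ → ℕ → Set
Scheme k zero    = Vec (Fin k) zero ⤖ Fin (k ^ zero)
Scheme k (suc d) = (Vec (Fin k) (suc d) ⤖ Fin (k ^ suc d))
                 × (Fin k → Scheme k d)

rootMap : ∀ {k d} → Scheme k d → Vec (Fin k) d → Fin (k ^ d)
rootMap {d = zero}  β = Bijection.to β
rootMap {d = suc d} β = Bijection.to (proj₁ β)

subScheme : ∀ {k d} → Scheme k (suc d) → Fin k → Scheme k d
subScheme β c = proj₂ β c

-- The root forms a collision w.r.t. (A, β).
-- For d = 0 the root has no children, so distinct children u_1..u_k exist
-- only if k = 0 (in which case the condition holds vacuously).
RootCollision : ∀ {k d} → Pred (Vec (Fin k) d) 0ℓ → Scheme k d → Set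
RootCollision {k} {zero}  A β = Fin k → ⊥
RootCollision {k} {suc d} A β =
  Σ[ u ∈ (Fin k → Fin k) ] Injective _≡_ _≡_ u ×
  Σ[ a ∈ (Fin k → Vec (Fin k) d) ]                          -- a_i = u_i followed by a i
    (∀ i → A (u i ∷ a i)) ×
    (∀ i j → rootMap (subScheme β (u i)) (a i)
           ≡ rootMap (subScheme β (u j)) (a j))

ExistsCollision : ∀ {k d} → Pred (Vec (Fin k) d) 0ℓ → Scheme k d → Set
ExistsCollision {k} {zero}  A β = RootCollision A β
ExistsCollision {k} {suc d} A β =
  RootCollision A β
  ⊎ Σ[ c ∈ Fin k ] ExistsCollision (λ w → A (c ∷ w)) (subScheme β c)

-- The instance J_{k,d}(I, β).  J I n β is J_{k,n+1}(I,β): its requests are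
-- indexed by the leaves Vec (Fin k) (suc n) of T_{k,n+1}.

module Construction {k : ℕ} (I : Instance (Fin k)) where

  private
    D = graph I
    s = src I
    t = tgt I

  module Step {n : ℕ}
              (Js : Fin k → Instance (Vec (Fin k) (suc n)))
              (f  : Fin k → Vec (Fin k) (suc n) → Fin (k ^ suc n))
              where

    -- disjoint union of J_1..J_k and k^(n+1) copies I_1.. of I (paper depth n+2)
    JV : Set
    JV = (Σ[ i ∈ Fin k ] V (graph (Js i))) ⊎ (Fin (k ^ suc n) × V D)

    data JArc : JV → JV → Set where
      inner : ∀ {i x y} → Arc (graph (Js i)) x y
            → JArc (inj₁ (i , x)) (inj₁ (i , y))
      copy  : ∀ {c x y} → Arc D x y
            → JArc (inj₂ (c , x)) (inj₂ (c , y))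
      link  : ∀ i v
            → JArc (inj₁ (i , tgt (Js i) v)) (inj₂ (f i v , s i))

    JD : Digraph
    JD = record { V = JV ; Arc = JArc }

    Jsrc : Vec (Fin k) (suc (suc n)) → JV
    Jsrc (i ∷ v) = inj₁ (i , src (Js i) v)

    Jtgt : Vec (Fin k) (suc (suc n)) → JV
    Jtgt (i ∷ v) = inj₂ (f i v , t i)

  J : (n : ℕ) → Scheme k (suc n) → Instance (Vec (Fin k) (suc n))
  -- d = 1: J_{k,1}(I,β) = I, request i indexed by the leaf [i]
  J zero β = record
    { graph = D
    ; src   = λ { (i ∷ _) → s i }
    ; tgt   = λ { (i ∷ _) → t i } }
  J (suc n) β = record
    { graph = JD
    ; src   = Jsrc
    ; tgt   = Jtgt }
    where
      open Step {n} (λ i → J n (subScheme β i))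
                    (λ i → rootMap (subScheme β i))

open Construction public using (J)

-- A path of J_{k,d+1} for a request below the child c of the root leaves the
-- copy J_c only through an arc into some copy I_j, which it never leaves; so
-- its part inside J_c is a path for the corresponding request of J_c, and its
-- part inside I_j is a path for a request of I.  Restricting a solution in the
-- first way lets a collision below the root be found by induction on the
-- depth.  A collision at the root yields leaves a_1,..,a_k, below distinct
-- children (hence one for every request i of I), all sent to the same copy
-- I_j; restricting in the second way to I_j serves all requests of I, which
-- is impossible for a no-instance.
module Submission where

open import Defs
open import Level using (0ℓ)
open import Data.Nat using (ℕ; suc; zero; _^_)
open import Data.Nat.Properties using (1+n≰n)
open import Data.Fin using (Fin; zero; punchOut)
open import Data.Fin.Properties using (_≟_; any?; punchOut-injective; injective⇒≤)
open import Data.Vec using (Vec; _∷_)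
open import Data.List using (List; []; _∷_; map)
open import Data.List.Membership.Propositional.Properties using (∈-map⁺)
open import Data.List.Relation.Unary.All as All using (All; []; _∷_)
open import Data.List.Relation.Unary.Any using (Any; here; there)
open import Data.List.Relation.Unary.AllPairs using (AllPairs; []; _∷_)
open import Data.List.Relation.Unary.Unique.Propositional using (Unique)
import Data.List.Relation.Unary.Unique.Propositional.Properties as Unique
open import Data.List.Relation.Binary.Sublist.Propositional using (_⊆_; []; _∷_; _∷ʳ_; minimum)
open import Data.List.Relation.Binary.Sublist.Propositional.Properties using (All-resp-⊆; Any-resp-⊆)
open import Data.Maybe using (Maybe; just; nothing; maybe′)
import Data.Maybe.Relation.Unary.Any as Maybe
open import Data.Product using (Σ; Σ-syntax; _×_; _,_; proj₁)
open import Data.Product.Properties using (,-injectiveˡ; ,-injectiveʳ-UIP)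
open import Data.Sum using (inj₁; inj₂)
open import Data.Sum.Properties using (inj₁-injective; inj₂-injective)
open import Function.Bundles using (Bijection)
open import Function.Definitions using (Injective; Surjective)
open import Relation.Binary.Core using (Rel)
open import Relation.Binary.PropositionalEquality using (_≡_; _≢_; refl; sym; trans; cong)
open import Axiom.UniquenessOfIdentityProofs using (module Decidable⇒UIP)
open import Relation.Nullary using (¬_; yes; no; contradiction)
open import Relation.Unary using (Pred)

AllPairs-resp-⊇ : ∀ {a r} {A : Set a} {R : Rel A r} {xs ys : List A}
                → xs ⊆ ys → AllPairs R ys → AllPairs R xs
AllPairs-resp-⊇ []         []         = []
AllPairs-resp-⊇ (_ ∷ʳ τ)   (_ ∷ rys)  = AllPairs-resp-⊇ τ rys
AllPairs-resp-⊇ (refl ∷ τ) (ry ∷ rys) = All-resp-⊆ τ ry ∷ AllPairs-resp-⊇ τ rys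

Disjoint-resp-⊇ : ∀ {A B : Set} (e : A → B) {xs xs′ : List A} {ys ys′ : List B}
                → map e xs ⊆ ys → map e xs′ ⊆ ys′ → Disjoint ys ys′ → Disjoint xs xs′
Disjoint-resp-⊇ e τ τ′ ys#ys′ v∈xs v∈xs′ =
  ys#ys′ (Any-resp-⊆ τ (∈-map⁺ e v∈xs)) (Any-resp-⊆ τ′ (∈-map⁺ e v∈xs′))

injective⇒surjective : ∀ {k} {u : Fin k → Fin k} → Injective _≡_ _≡_ u → Surjective _≡_ _≡_ u
injective⇒surjective {zero}  _ ()
injective⇒surjective {suc k} {u} u-inj r with any? (λ i → u i ≟ r)
... | yes (i , ui≡r) = i , λ { refl → ui≡r }
... | no ∄i = contradiction (injective⇒≤ {f = missR} missR-injective) 1+n≰n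
  where
    r≢u : ∀ i → r ≢ u i
    r≢u i r≡ui = ∄i (i , sym r≡ui)

    missR : Fin (suc k) → Fin k
    missR i = punchOut (r≢u i)

    missR-injective : Injective _≡_ _≡_ missR
    missR-injective {i} {j} eq = u-inj (punchOut-injective (r≢u i) (r≢u j) eq)

subpath : ∀ {D D′ : Digraph} (e : V D′ → V D) {x y a b} (w′ : Walk D′ x y) {w : Walk D a b}
        → map e (walkVerts D′ w′) ⊆ walkVerts D w → Unique (walkVerts D w) → Path D′ x y
subpath e w′ τ w! = mkPath w′ (Unique.map⁻ (AllPairs-resp-⊇ τ w!))

_#_ : ∀ {D} → SomePath D → SomePath D → Set
_#_ {D} p q = Disjoint (pathVerts D p) (pathVerts D q)

HasRequest : ∀ {R} (I : Instance R) → SomePath (graph I) → Set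
HasRequest {R} I p = Σ R (IsPathFor I p)

serves-injective-image⇒YesInstance : ∀ {k} {I : Instance (Fin k)} (S : Solution I) {u : Fin k → Fin k}
  → Injective _≡_ _≡_ u → (∀ i → Serves I S (u i)) → YesInstance I
serves-injective-image⇒YesInstance S u-inj serves = S , serves-all
  where
    serves-all : ∀ r → Serves _ S r
    serves-all r with i , ui≡r ← injective⇒surjective u-inj r with refl ← ui≡r refl = serves i

NoInstance⇒request : ∀ {k} {I : Instance (Fin k)} → NoInstance I → Fin k
NoInstance⇒request {zero}  noI = contradiction (record { paths = [] ; forRequest = [] ; disjoint = [] } , λ ()) noI
NoInstance⇒request {suc k} noI = zero

-- A solution of I yields one of I′ as soon as every path of the solution can
-- be cut down (or dropped) to a path of I′ whose vertices embed into it.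
module Restriction {R R′ : Set} (I : Instance R) (I′ : Instance R′)
                   (e : V (graph I′) → V (graph I)) where

  _⊑_ : SomePath (graph I′) → SomePath (graph I) → Set
  q ⊑ p = map e (pathVerts (graph I′) q) ⊆ pathVerts (graph I) p

  record Piece (p : SomePath (graph I)) : Set where
    field
      path    : SomePath (graph I′)
      request : HasRequest I′ path
      inside  : path ⊑ p

  module _ (restrict : ∀ p → HasRequest I p → Maybe (Piece p)) where

    restrictPaths : ∀ ps → All (HasRequest I) ps → List (SomePath (graph I′))
    restrictPaths []       []       = []
    restrictPaths (p ∷ ps) (r ∷ rs) =
      maybe′ (λ π → Piece.path π ∷ restrictPaths ps rs) (restrictPaths ps rs) (restrict p r)

    restrictPaths-request : ∀ ps rs → All (HasRequest I′) (restrictPaths ps rs)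
    restrictPaths-request []       []       = []
    restrictPaths-request (p ∷ ps) (r ∷ rs) with restrict p r
    ... | nothing = restrictPaths-request ps rs
    ... | just π  = Piece.request π ∷ restrictPaths-request ps rs

    restrictPaths-inside : ∀ ps rs → All (λ q → Any (q ⊑_) ps) (restrictPaths ps rs)
    restrictPaths-inside []       []       = []
    restrictPaths-inside (p ∷ ps) (r ∷ rs) with restrict p r
    ... | nothing = All.map there (restrictPaths-inside ps rs)
    ... | just π  = here (Piece.inside π) ∷ All.map there (restrictPaths-inside ps rs)

    restrictPaths-disjoint : ∀ ps rs → AllPairs _#_ ps → AllPairs _#_ (restrictPaths ps rs)
    restrictPaths-disjoint []       []       []         = []
    restrictPaths-disjoint (p ∷ ps) (r ∷ rs) (p# ∷ ps#) with restrict p r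
    ... | nothing = restrictPaths-disjoint ps rs ps#
    ... | just π  =
      All.map (λ {q} → apart {q}) (restrictPaths-inside ps rs) ∷ restrictPaths-disjoint ps rs ps#
      where
        apart : ∀ {q} → Any (q ⊑_) ps → Piece.path π # q
        apart {q} = All.lookupWith {P = p #_} {R = λ _ → Piece.path π # q}
                                   (λ p#p′ q⊑p′ → Disjoint-resp-⊇ e (Piece.inside π) q⊑p′ p#p′) p#

    restrictPaths-serves : ∀ {r r′}
      → (∀ p pr → IsPathFor I p r → Maybe.Any (λ π → IsPathFor I′ (Piece.path π) r′) (restrict p pr))
      → ∀ ps rs → Any (λ p → IsPathFor I p r) ps → Any (λ q → IsPathFor I′ q r′) (restrictPaths ps rs)
    restrictPaths-serves cut (p ∷ ps) (pr ∷ rs) (here p-for-r) with restrict p pr | cut p pr p-for-r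
    ... | just π | Maybe.just π-for-r′ = here π-for-r′
    restrictPaths-serves cut (p ∷ ps) (pr ∷ rs) (there ps-serve) with restrict p pr
    ... | nothing = restrictPaths-serves cut ps rs ps-serve
    ... | just _  = there (restrictPaths-serves cut ps rs ps-serve)

    restrictSolution : Solution I → Solution I′
    restrictSolution S = record
      { paths      = restrictPaths (paths S) (forRequest S)
      ; forRequest = restrictPaths-request (paths S) (forRequest S)
      ; disjoint   = restrictPaths-disjoint (paths S) (forRequest S) (disjoint S)
      }

module StepWalks {k n : ℕ} (I : Instance (Fin k))
                 (Js : Fin k → Instance (Vec (Fin k) (suc n)))
                 (f  : Fin k → Vec (Fin k) (suc n) → Fin (k ^ suc n)) where
  open Construction.Step I Js f

  inPart : ∀ i → V (graph (Js i)) → JV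
  inPart i x = inj₁ (i , x)

  inCopy : Fin (k ^ suc n) → V (graph I) → JV
  inCopy c x = inj₂ (c , x)

  walk-in-copy : ∀ {c c′ x y} (w : Walk JD (inCopy c x) (inCopy c′ y))
               → c ≡ c′ × Σ[ w′ ∈ Walk (graph I) x y ] map (inCopy c) (walkVerts _ w′) ⊆ walkVerts JD w
  walk-in-copy []           = refl , [] , refl ∷ []
  walk-in-copy (copy a ∷ w) with c≡c′ , w′ , τ ← walk-in-copy w = c≡c′ , a ∷ w′ , refl ∷ τ

  record Crossing {i x c y} (w : Walk JD (inPart i x) (inCopy c y)) : Set where
    field
      leaf     : Vec (Fin k) (suc n)
      lands    : f i leaf ≡ c
      before   : Walk (graph (Js i)) x (tgt (Js i) leaf)
      after    : Walk (graph I) (src I i) y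
      before-⊆ : map (inPart i) (walkVerts _ before) ⊆ walkVerts JD w
      after-⊆  : map (inCopy c) (walkVerts _ after) ⊆ walkVerts JD w

  crossing : ∀ {i x c y} (w : Walk JD (inPart i x) (inCopy c y)) → Crossing w
  crossing (inner a ∷ w) = record
    { leaf     = leaf
    ; lands    = lands
    ; before   = a ∷ before
    ; after    = after
    ; before-⊆ = refl ∷ before-⊆
    ; after-⊆  = _ ∷ʳ after-⊆
    }
    where open Crossing (crossing w)
  crossing (link i v ∷ w) with refl , w′ , τ ← walk-in-copy w = record
    { leaf     = v
    ; lands    = refl
    ; before   = []
    ; after    = w′
    ; before-⊆ = refl ∷ minimum _
    ; after-⊆  = _ ∷ʳ τ
    }

module Layer {k n : ℕ} (I : Instance (Fin k)) (β : Scheme k (suc (suc n))) where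

  private
    Js : Fin k → Instance (Vec (Fin k) (suc n))
    Js c = J I n (subScheme β c)

    f : Fin k → Vec (Fin k) (suc n) → Fin (k ^ suc n)
    f c = rootMap (subScheme β c)

    J′ : Instance (Vec (Fin k) (suc (suc n)))
    J′ = J I (suc n) β

  open StepWalks I Js f

  f-injective : ∀ c {v w} → f c v ≡ f c w → v ≡ w
  f-injective c = Bijection.injective (proj₁ (subScheme β c))

  module ToChild (c : Fin k) where
    open Restriction J′ (Js c) (inPart c) public

    cut : ∀ p → HasRequest J′ p → Maybe (Piece p)
    cut (somePath _ _ (mkPath w w!)) (r₀ ∷ r , refl , refl) with r₀ ≟ c
    ... | no _     = nothing
    ... | yes refl = just record
      { path    = somePath _ _ (subpath (inPart c) before before-⊆ w!)
      ; request = r , refl , cong (tgt (Js c)) (f-injective c lands)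
      ; inside  = before-⊆
      }
      where open Crossing (crossing w)

    cut-serves : ∀ {w} p pr → IsPathFor J′ p (c ∷ w)
               → Maybe.Any (λ π → IsPathFor (Js c) (Piece.path π) w) (cut p pr)
    cut-serves (somePath _ _ (mkPath w _)) (r₀ ∷ r , refl , refl) (src≡ , tgt≡) with r₀ ≟ c
    ... | no r₀≢c  = contradiction (,-injectiveˡ (inj₁-injective src≡)) r₀≢c
    ... | yes refl = Maybe.just
      ( ,-injectiveʳ-UIP (Decidable⇒UIP.≡-irrelevant _≟_) (inj₁-injective src≡)
      , cong (tgt (Js c)) (f-injective c (trans lands (,-injectiveˡ (inj₂-injective tgt≡)))) )
      where open Crossing (crossing w)

  restrictToChild : ∀ c → Solution J′ → Solution (Js c)
  restrictToChild c = ToChild.restrictSolution c (ToChild.cut c)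

  restrictToChild-serves : ∀ c (S : Solution J′) {w}
                         → Serves J′ S (c ∷ w) → Serves (Js c) (restrictToChild c S) w
  restrictToChild-serves c S =
    ToChild.restrictPaths-serves c (ToChild.cut c) (ToChild.cut-serves c) (paths S) (forRequest S)

  module ToCopy (c₀ : Fin (k ^ suc n)) where
    open Restriction J′ I (inCopy c₀) public

    cut : ∀ p → HasRequest J′ p → Maybe (Piece p)
    cut (somePath _ _ (mkPath w w!)) (r₀ ∷ r , refl , refl) with f r₀ r ≟ c₀
    ... | no _     = nothing
    ... | yes refl = just record
      { path    = somePath _ _ (subpath (inCopy c₀) after after-⊆ w!)
      ; request = r₀ , refl , refl
      ; inside  = after-⊆
      }
      where open Crossing (crossing w)

    cut-serves : ∀ {r w} → f r w ≡ c₀ → ∀ p pr → IsPathFor J′ p (r ∷ w)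
               → Maybe.Any (λ π → IsPathFor I (Piece.path π) r) (cut p pr)
    cut-serves frw≡c₀ (somePath _ _ (mkPath w _)) (r₀ ∷ r , refl , refl) (src≡ , tgt≡)
      with f r₀ r ≟ c₀
    ... | no fr₀r≢c₀ = contradiction (trans (,-injectiveˡ (inj₂-injective tgt≡)) frw≡c₀) fr₀r≢c₀
    ... | yes refl with refl ← ,-injectiveˡ (inj₁-injective src≡) = Maybe.just (refl , refl)

  restrictToCopy : Fin (k ^ suc n) → Solution J′ → Solution I
  restrictToCopy c₀ = ToCopy.restrictSolution c₀ (ToCopy.cut c₀)

  restrictToCopy-serves : ∀ {c₀ r w} (S : Solution J′) → f r w ≡ c₀
                        → Serves J′ S (r ∷ w) → Serves I (restrictToCopy c₀ S) r
  restrictToCopy-serves {c₀} S frw≡c₀ =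
    ToCopy.restrictPaths-serves c₀ (ToCopy.cut c₀) (ToCopy.cut-serves c₀ frw≡c₀) (paths S) (forRequest S)

fromDepthOne : ∀ {k} {I : Instance (Fin k)} {β : Scheme k 1} → Solution (J I zero β) → Solution I
fromDepthOne S = record
  { paths      = paths S
  ; forRequest = All.map (λ { (i ∷ _ , p-for-i) → i , p-for-i }) (forRequest S)
  ; disjoint   = disjoint S
  }

open Layer using (restrictToChild; restrictToChild-serves; restrictToCopy; restrictToCopy-serves)

lemma10 : (k d : ℕ) (A : Pred (Vec (Fin k) (suc d)) 0ℓ) (β : Scheme k (suc d))
    → ExistsCollision A β
    → (I : Instance (Fin k)) → IsDAG (graph I) → NoInstance I
    → ¬ (Σ (Solution (J I d β)) λ S → ∀ v → A v → Serves (J I d β) S v)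
lemma10 k zero A β (inj₁ (u , u-inj , a , a∈A , _)) I _ noI (S , serves) =
  noI (serves-injective-image⇒YesInstance (fromDepthOne {β = β} S) u-inj λ i → serves (u i ∷ a i) (a∈A i))
lemma10 k zero A β (inj₂ (c , no-children)) I _ _ _ = no-children c
lemma10 k (suc n) A β (inj₂ (c , collision)) I dag noI (S , serves) =
  lemma10 k n (λ w → A (c ∷ w)) (subScheme β c) collision I dag noI
    (restrictToChild I β c S , λ w w∈A → restrictToChild-serves I β c S (serves (c ∷ w) w∈A))
lemma10 k (suc n) A β (inj₁ (u , u-inj , a , a∈A , same)) I _ noI (S , serves) =
  noI (serves-injective-image⇒YesInstance (restrictToCopy I β c₀ S) u-inj λ i →
         restrictToCopy-serves I β {r = u i} {w = a i} S (same i i₀) (serves (u i ∷ a i) (a∈A i)))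
  where
    i₀ : Fin k
    i₀ = NoInstance⇒request noI

    c₀ : Fin (k ^ suc n)
    c₀ = rootMap (subScheme β (u i₀)) (a i₀)
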